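{- Let $(f,w)$ be a $(1\pm\varepsilon)$-approximate $h$-length $S$-$T$ flow, moving cut pair in a digraph $D=(V,A)$ with capacities $U$ and lengths $\ell$. Then at least one of the following holds: (1) $\sum_{a\in A'}U_aw_a\ge(\frac12-3\varepsilon)\sum_aU_aw_a$, where $A'=\{a\in\delta^\pm(S,T): a\text{ is }\tfrac12\text{ -saturated by }f\}$; (2) $\text{OPT}_w\le\frac12\text{OPT}$, where $\text{OPT}$ is the maximum value of an $h$-length $S$-$T$ flow in $D$ with capacities $U$ and lengths $\ell$, and $\text{OPT}_w$ is the maximum value of an $h$-length $S$-$T$ flow in $D$ with capacities $U$ and lengths $\ell'$ given by $\ell'_a=\ell_a$ for $a\in\delta^\pm(S,T)$ and $\ell'_a=\ell_a+\frac1\varepsilon h\,w_a$ for $a\notin\delta^\pm(S,T)$.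
   Context: Capacities $U_a\ge0$, lengths $\ell_a>0$. For lengths $\lambda$ (here $\ell$ or $\ell'$), $\mathcal{P}_h(S,T)$ is the set of simple directed $S$ to $T$ paths $P$ with $\sum_{a\in P}\lambda_a\le h$. An $h$-length $S$-$T$ flow assigns $f_P\ge0$ to $P\in\mathcal{P}_h(S,T)$ with $f(a)=\sum_{P\ni a}f_P\le U_a$; $\text{val}(f)=\sum_Pf_P$. An $h$-length moving cut is $w:A\to\mathbb{R}_{\ge0}$ with $\sum_{a\in P}w_a\ge1$ for all $P\in\mathcal{P}_h(S,T)$ (w.r.t. lengths $\ell$). The pair $(f,w)$ (both feasible) is $(1\pm\varepsilon)$-approximate if $(1-\varepsilon)\sum_aU_aw_a\le\text{val}(f)$. An arc $a$ is $c$-saturated by $f$ (for $c\in[0,1]$) if $cU_a\le f(a)$. $\delta^\pm(S,T)=\bigcup_{v\in S}\delta^+(v)\cup\bigcup_{v\in T}\delta^-(v)$, where $\delta^+(v)$, $\delta^-(v)$ are the out- and in-arcs of $v$.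
   Formalization: The capacities $U$, lengths $\ell$, the numbers h and ε, the path flow values $f_P$ and the moving-cut weights $w_a$ are rational rather than real. -}

module Defs where

open import Data.Nat using (ℕ)
open import Data.Fin using (Fin)
open import Data.Fin.Subset using (Subset; _∈_)
open import Data.Bool using (Bool; true; false; if_then_else_; _∨_; _∧_)
open import Data.List using (List; []; _∷_; map)
open import Data.List.NonEmpty using (List⁺; _∷_; toList; last)
import Data.List.NonEmpty as L⁺
open import Data.List.Membership.Propositional renaming (_∈_ to _∈ₗ_) using ()
open import Data.List.Relation.Unary.Unique.Propositional using (Unique)
open import Data.List.Relation.Unary.Linked using (Linked)
open import Data.Product using (Σ; _×_; _,_; proj₁; proj₂)
open import Data.Rational using (ℚ; 0ℚ; 1ℚ; _+_; _*_; _-_; _≤_; _<_; 1/_; Positive; ½)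
open import Data.Rational.Properties using (pos⇒nonZero)
import Data.Rational.Properties as ℚP
open import Relation.Binary.PropositionalEquality using (_≡_)
open import Relation.Nullary.Decidable using (⌊_⌋)
open import Data.Fin.Properties using (_≟_)
open import Data.Fin.Subset.Properties using (_∈?_)
open import Data.List.Relation.Unary.Any using (any?)

record Digraph : Set where
  field
    n  : ℕ
    m  : ℕ
    tl : Fin m → Fin n
    hd : Fin m → Fin n

open Digraph public

∑ : ∀ {k} → (Fin k → ℚ) → ℚ
∑ {ℕ.zero}  f = 0ℚ
∑ {ℕ.suc k} f = f Fin.zero + ∑ (λ i → f (Fin.suc i))

sumList : List ℚ → ℚ
sumList []       = 0ℚ
sumList (x ∷ xs) = x + sumList xs

pathSum : ∀ {k} → (Fin k → ℚ) → List⁺ (Fin k) → ℚ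
pathSum λ' P = sumList (map λ' (toList P))

record HPath (D : Digraph) (S T : Subset (n D)) (λ' : Fin (m D) → ℚ) (h : ℚ) : Set where
  field
    arcs   : List⁺ (Fin (m D))
    chain  : Linked (λ a b → hd D a ≡ tl D b) (toList arcs)
    startS : tl D (L⁺.head arcs) ∈ S
    endT   : hd D (last arcs) ∈ T
    simple : Unique (tl D (L⁺.head arcs) ∷ map (hd D) (toList arcs))
    short  : pathSum λ' arcs ≤ h

open HPath public

uses : ∀ {D S T λ' h} → HPath D S T λ' h → Fin (m D) → Bool
uses P a = ⌊ any? (a ≟_) (toList (arcs P)) ⌋

-- An h-length S–T flow (w.r.t. lengths λ'), given by its finitely many
-- path values f_P (paths not listed carry zero flow).
record Flow (D : Digraph) (S T : Subset (n D)) (U λ' : Fin (m D) → ℚ) (h : ℚ) : Set where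
  field
    paths  : List (HPath D S T λ' h × ℚ)
    nonneg : ∀ {p} → p ∈ₗ paths → 0ℚ ≤ proj₂ p
  load : Fin (m D) → ℚ
  load a = sumList (map (λ p → if uses (proj₁ p) a then proj₂ p else 0ℚ) paths)
  field
    capacity : ∀ a → load a ≤ U a
  val : ℚ
  val = sumList (map proj₂ paths)

open Flow public

-- f is a maximum h-length S–T flow (so val f = OPT).
IsMaxFlow : ∀ {D S T U λ' h} → Flow D S T U λ' h → Set
IsMaxFlow {D} {S} {T} {U} {λ'} {h} f = ∀ (g : Flow D S T U λ' h) → val g ≤ val f

IsMovingCut : (D : Digraph) (S T : Subset (n D)) (ℓ : Fin (m D) → ℚ) (h : ℚ) → (Fin (m D) → ℚ) → Set
IsMovingCut D S T ℓ h w = (∀ a → 0ℚ ≤ w a) × (∀ (P : HPath D S T ℓ h) → 1ℚ ≤ pathSum w (arcs P))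

inδ± : (D : Digraph) (S T : Subset (n D)) → Fin (m D) → Bool
inδ± D S T a = ⌊ tl D a ∈? S ⌋ ∨ ⌊ hd D a ∈? T ⌋

saturated : ∀ {D S T U λ' h} → ℚ → Flow D S T U λ' h → Fin (m D) → Bool
saturated {U = U} c f a = ⌊ c * U a ℚP.≤? load f a ⌋

cutValue : ∀ {k} → (Fin k → ℚ) → (Fin k → ℚ) → ℚ
cutValue U w = ∑ (λ a → U a * w a)

A'Value : ∀ {D S T U λ' h} → Flow D S T U λ' h → (Fin (m D) → ℚ) → ℚ
A'Value {D} {S} {T} {U} f w =
  ∑ (λ a → if inδ± D S T a ∧ saturated ½ f a then U a * w a else 0ℚ)

ℓ' : (D : Digraph) (S T : Subset (n D)) (ℓ w : Fin (m D) → ℚ) (h ε : ℚ) → .{{Positive ε}} → Fin (m D) → ℚ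
ℓ' D S T ℓ w h ε a =
  if inδ± D S T a then ℓ a else ℓ a + (1/ ε) {{pos⇒nonZero ε}} * h * w a

-- Let C = Σ_a U_a w_a.  Every flow path of f has w-length ≥ 1, so val f ≤ Σ_a f(a) w_a,
-- and an arc of δ±(S,T) that is not ½-saturated has 2 f(a) < U_a, so
--   Σ_{a ∈ δ±} U_a w_a + 2 Σ_a f(a) w_a ≤ A' + 2C.
-- For h > 0 a path of ℓ'-length ≤ h has ℓ-length ≤ h and w-weight < ε off δ±, hence
-- w-weight ≥ 1 − ε on δ±, so (1 − ε) OPT_w ≤ Σ_{a ∈ δ±} U_a w_a.  If A' ≤ (½ − 3ε) C,
-- then together with (1 − ε) C ≤ val f ≤ OPT this gives
--   (1 − ε) OPT_w ≤ (½ − ε) C ≤ ½ (1 − ε)² C ≤ (1 − ε) ½ OPT.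
module Submission where

open import Algebra.Bundles using (CommutativeMonoid; CommutativeRing)
open import Data.Bool using (Bool; true; false; if_then_else_; not; _∧_)
open import Data.Empty using (⊥; ⊥-elim)
open import Data.Fin using (Fin; zero; suc)
open import Data.Fin.Properties using (_≟_)
open import Data.Fin.Subset using (Subset)
open import Data.List using (List; []; _∷_; map)
open import Data.List.Membership.Propositional using (_∈_)
open import Data.List.NonEmpty using (List⁺; _∷_; toList)
open import Data.List.Relation.Unary.All using (All)
open import Data.List.Relation.Unary.All.Properties.Core using (All¬⇒¬Any)
open import Data.List.Relation.Unary.AllPairs using ([]; _∷_)
import Data.List.Relation.Unary.AllPairs as AllPairs
open import Data.List.Relation.Unary.Any using (here; there; any?)
open import Data.List.Relation.Unary.Unique.Propositional using (Unique)
open import Data.List.Relation.Unary.Unique.Propositional.Properties using (map⁻)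
open import Data.Nat using (ℕ)
open import Data.Product using (_×_; _,_; proj₁; proj₂)
open import Data.Rational
  using (ℚ; 0ℚ; 1ℚ; _+_; _*_; _-_; -_; _≤_; _<_; Positive; ½; 1/_; positive; nonNegative; nonPositive)
open import Data.Rational.Properties hiding (_≟_)
open import Data.Rational.Solver using (module +-*-Solver)
open import Data.Sum using (_⊎_; inj₁; inj₂)
open import Function using (_∘_)
open import Relation.Binary.PropositionalEquality
  using (_≡_; _≢_; refl; sym; trans; cong; cong₂; subst; subst₂; module ≡-Reasoning)
open import Relation.Nullary using (yes; no)
open import Relation.Nullary.Decidable using (⌊_⌋)

open import Algebra.Properties.CommutativeSemigroup
  (CommutativeMonoid.commutativeSemigroup +-0-commutativeMonoid) using (interchange)
open import Algebra.Properties.Semiring.Sum (CommutativeRing.semiring +-*-commutativeRing)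
  using (sum; ∑-distrib-+; *-distribˡ-sum; sum-cong-≗; sum-replicate-zero)

open import Defs

open +-*-Solver

private
  variable
    k : ℕ
    p q r : ℚ

*-monoˡ-≤-0≤ : 0ℚ ≤ r → p ≤ q → r * p ≤ r * q
*-monoˡ-≤-0≤ {r} 0≤r = *-monoˡ-≤-nonNeg r {{nonNegative 0≤r}}

*-monoʳ-≤-0≤ : 0ℚ ≤ r → p ≤ q → p * r ≤ q * r
*-monoʳ-≤-0≤ {r} 0≤r = *-monoʳ-≤-nonNeg r {{nonNegative 0≤r}}

*-nonNeg : 0ℚ ≤ p → 0ℚ ≤ q → 0ℚ ≤ p * q
*-nonNeg {p} {q} 0≤p 0≤q = subst (_≤ p * q) (*-zeroʳ p) (*-monoˡ-≤-0≤ 0≤p 0≤q)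

p<q⇒0<q-p : p < q → 0ℚ < q - p
p<q⇒0<q-p {p} {q} p<q = subst (_< q - p) (+-inverseʳ p) (+-monoˡ-< (- p) p<q)

+-cancelʳ-≤ : ∀ r → p + r ≤ q + r → p ≤ q
+-cancelʳ-≤ {p} {q} r p+r≤q+r = subst₂ _≤_ (+-r-r p) (+-r-r q) (+-monoˡ-≤ (- r) p+r≤q+r)
  where
  +-r-r : ∀ x → x + r - r ≡ x
  +-r-r x = trans (+-assoc x r (- r)) (trans (cong (x +_) (+-inverseʳ r)) (+-identityʳ x))

*≤0⇒≤0 : ∀ r .{{_ : Positive r}} → r * p ≤ 0ℚ → p ≤ 0ℚ
*≤0⇒≤0 r rp≤0 = *-cancelˡ-≤-pos r (subst (r * _ ≤_) (sym (*-zeroʳ r)) rp≤0)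

½-3ε≤0 : ∀ {ε} → 1ℚ ≤ ε → ½ - (1ℚ + 1ℚ + 1ℚ) * ε ≤ 0ℚ
½-3ε≤0 {ε} 1≤ε = begin
  ½ - (1ℚ + 1ℚ + 1ℚ) * ε   ≤⟨ +-monoʳ-≤ ½ (neg-antimono-≤ 3≤3ε) ⟩
  ½ - (1ℚ + 1ℚ + 1ℚ) * 1ℚ  ≤⟨ ≤ᵇ⇒≤ _ ⟩
  0ℚ                       ∎
  where
  open ≤-Reasoning
  3≤3ε : (1ℚ + 1ℚ + 1ℚ) * 1ℚ ≤ (1ℚ + 1ℚ + 1ℚ) * ε
  3≤3ε = *-monoˡ-≤-nonNeg (1ℚ + 1ℚ + 1ℚ) 1≤ε

h*N<h*ε : ∀ {ε h L N} .{{_ : Positive ε}} → 0ℚ < L →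
  L + (1/ ε) {{pos⇒nonZero ε}} * h * N ≤ h → h * N < h * ε
h*N<h*ε {ε} {h} {L} {N} 0<L short = begin-strict
  h * N                  ≡⟨ sym (+-identityˡ (h * N)) ⟩
  0ℚ + h * N             ≡⟨ cong (_+ h * N) (sym (*-zeroʳ ε)) ⟩
  ε * 0ℚ + h * N         <⟨ +-monoˡ-< (h * N) (*-monoʳ-<-pos ε 0<L) ⟩
  ε * L + h * N          ≡⟨ sym ε-expand ⟩
  ε * (L + ε⁻¹ * h * N)  ≤⟨ *-monoˡ-≤-nonNeg ε {{pos⇒nonNeg ε}} short ⟩
  ε * h                  ≡⟨ *-comm ε h ⟩
  h * ε                  ∎
  where
  open ≤-Reasoning
  ε⁻¹ : ℚ
  ε⁻¹ = (1/ ε) {{pos⇒nonZero ε}}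
  ε-expand : ε * (L + ε⁻¹ * h * N) ≡ ε * L + h * N
  ε-expand = trans
    (solve 5 (λ ε i L h N → ε :* (L :+ i :* h :* N) := ε :* L :+ (ε :* i) :* (h :* N)) refl ε ε⁻¹ L h N)
    (trans (cong (λ t → ε * L + t * (h * N)) (*-inverseʳ ε {{pos⇒nonZero ε}}))
           (cong (ε * L +_) (*-identityˡ (h * N))))

halving-bound : ∀ {ε C A vf vg vo} → 0ℚ ≤ ε → ε < 1ℚ → 0ℚ ≤ C
  → (1ℚ - ε) * C ≤ vf → vf ≤ vo → A ≤ (½ - (1ℚ + 1ℚ + 1ℚ) * ε) * C
  → (1ℚ - ε) * vg + (vf + vf) ≤ A + (C + C)
  → vg ≤ ½ * vo
halving-bound {ε} {C} {A} {vf} {vg} {vo} 0≤ε ε<1 0≤C approx vf≤vo A-small budget =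
  *-cancelˡ-≤-pos (1ℚ - ε) {{positive 0<1-ε}} (begin
    (1ℚ - ε) * vg                    ≤⟨ vg-bound ⟩
    (½ - ε) * C                      ≡⟨ sym (+-identityʳ _) ⟩
    (½ - ε) * C + 0ℚ                 ≤⟨ +-monoʳ-≤ ((½ - ε) * C) 0≤ε²C/2 ⟩
    (½ - ε) * C + ½ * (ε * ε) * C    ≡⟨ square-completion ⟩
    (1ℚ - ε) * (½ * ((1ℚ - ε) * C))  ≤⟨ *-monoˡ-≤-0≤ (<⇒≤ 0<1-ε) (*-monoˡ-≤-0≤ 0≤½ C≤vo) ⟩
    (1ℚ - ε) * (½ * vo)              ∎)
  where
  open ≤-Reasoning
  0≤½ : 0ℚ ≤ ½
  0≤½ = nonNegative⁻¹ ½
  0<1-ε : 0ℚ < 1ℚ - ε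
  0<1-ε = p<q⇒0<q-p ε<1
  0≤ε²C/2 : 0ℚ ≤ ½ * (ε * ε) * C
  0≤ε²C/2 = *-nonNeg (*-nonNeg 0≤½ (*-nonNeg 0≤ε 0≤ε)) 0≤C
  C≤vo : (1ℚ - ε) * C ≤ vo
  C≤vo = ≤-trans approx vf≤vo
  square-completion : (½ - ε) * C + ½ * (ε * ε) * C ≡ (1ℚ - ε) * (½ * ((1ℚ - ε) * C))
  square-completion = solve 2 (λ ε C →
    (con ½ :- ε) :* C :+ con ½ :* (ε :* ε) :* C := (con 1ℚ :- ε) :* (con ½ :* ((con 1ℚ :- ε) :* C)))
    refl ε C
  regroup : (½ - (1ℚ + 1ℚ + 1ℚ) * ε) * C + (C + C) ≡ (½ - ε) * C + ((1ℚ - ε) * C + (1ℚ - ε) * C)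
  regroup = solve 2 (λ ε C →
    (con ½ :- (con 1ℚ :+ con 1ℚ :+ con 1ℚ) :* ε) :* C :+ (C :+ C)
      := (con ½ :- ε) :* C :+ ((con 1ℚ :- ε) :* C :+ (con 1ℚ :- ε) :* C)) refl ε C
  vg-bound : (1ℚ - ε) * vg ≤ (½ - ε) * C
  vg-bound = +-cancelʳ-≤ ((1ℚ - ε) * C + (1ℚ - ε) * C) (begin
    (1ℚ - ε) * vg + ((1ℚ - ε) * C + (1ℚ - ε) * C)  ≤⟨ +-monoʳ-≤ ((1ℚ - ε) * vg) (+-mono-≤ approx approx) ⟩
    (1ℚ - ε) * vg + (vf + vf)                      ≤⟨ budget ⟩
    A + (C + C)                                    ≤⟨ +-monoˡ-≤ (C + C) A-small ⟩
    (½ - (1ℚ + 1ℚ + 1ℚ) * ε) * C + (C + C)         ≡⟨ regroup ⟩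
    (½ - ε) * C + ((1ℚ - ε) * C + (1ℚ - ε) * C)    ∎)

if-* : ∀ (b : Bool) x y → (if b then x else 0ℚ) * y ≡ x * (if b then y else 0ℚ)
if-* true  x y = refl
if-* false x y = trans (*-zeroˡ y) (sym (*-zeroʳ x))

∑≡sum : (f : Fin k → ℚ) → ∑ f ≡ sum f
∑≡sum {ℕ.zero}  f = refl
∑≡sum {ℕ.suc k} f = cong (f zero +_) (∑≡sum (f ∘ suc))

∑-cong : {f g : Fin k → ℚ} → (∀ a → f a ≡ g a) → ∑ f ≡ ∑ g
∑-cong {f = f} {g} f≗g = trans (∑≡sum f) (trans (sum-cong-≗ f≗g) (sym (∑≡sum g)))

∑-zero : ∑ {k} (λ _ → 0ℚ) ≡ 0ℚ
∑-zero {k} = trans (∑≡sum {k} (λ _ → 0ℚ)) (sum-replicate-zero k)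

∑-+ : (f g : Fin k → ℚ) → ∑ (λ a → f a + g a) ≡ ∑ f + ∑ g
∑-+ f g = trans (∑≡sum (λ a → f a + g a))
  (trans (∑-distrib-+ f g) (sym (cong₂ _+_ (∑≡sum f) (∑≡sum g))))

∑-*ˡ : ∀ c (f : Fin k → ℚ) → ∑ (λ a → c * f a) ≡ c * ∑ f
∑-*ˡ c f = trans (∑≡sum (λ a → c * f a))
  (trans (sym (*-distribˡ-sum c f)) (cong (c *_) (sym (∑≡sum f))))

∑-mono : {f g : Fin k → ℚ} → (∀ a → f a ≤ g a) → ∑ f ≤ ∑ g
∑-mono {ℕ.zero}  _   = ≤-refl
∑-mono {ℕ.suc k} f≤g = +-mono-≤ (f≤g zero) (∑-mono (f≤g ∘ suc))

∑-nonNeg : {f : Fin k → ℚ} → (∀ a → 0ℚ ≤ f a) → 0ℚ ≤ ∑ f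
∑-nonNeg {k} {f} 0≤f = subst (_≤ ∑ f) (∑-zero {k}) (∑-mono 0≤f)

∑-pointMass : (x : Fin k) (c : Fin k → ℚ) → ∑ (λ a → if ⌊ a ≟ x ⌋ then c a else 0ℚ) ≡ c x
∑-pointMass {ℕ.suc k} zero c = trans (cong (c zero +_) (∑-zero {k})) (+-identityʳ (c zero))
∑-pointMass (suc x)  c = trans (+-identityˡ _) (trans (∑-cong shift) (∑-pointMass x (c ∘ suc)))
  where
  shift : ∀ i → (if ⌊ suc i ≟ suc x ⌋ then c (suc i) else 0ℚ)
                ≡ (if ⌊ i ≟ x ⌋ then c (suc i) else 0ℚ)
  shift i with i ≟ x
  ... | yes _ = refl
  ... | no _  = refl

module _ {X : Set} where

  sumList-cong : ∀ (xs : List X) {f g : X → ℚ} → (∀ x → f x ≡ g x) →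
                 sumList (map f xs) ≡ sumList (map g xs)
  sumList-cong []       _   = refl
  sumList-cong (x ∷ xs) f≗g = cong₂ _+_ (f≗g x) (sumList-cong xs f≗g)

  sumList-+ : ∀ (xs : List X) (f g : X → ℚ) →
              sumList (map (λ x → f x + g x) xs) ≡ sumList (map f xs) + sumList (map g xs)
  sumList-+ []       f g = refl
  sumList-+ (x ∷ xs) f g = trans (cong (f x + g x +_) (sumList-+ xs f g)) (interchange (f x) (g x) _ _)

  sumList-*ˡ : ∀ (xs : List X) c (f : X → ℚ) → sumList (map (λ x → c * f x) xs) ≡ c * sumList (map f xs)
  sumList-*ˡ []       c f = sym (*-zeroʳ c)
  sumList-*ˡ (x ∷ xs) c f =
    trans (cong (c * f x +_) (sumList-*ˡ xs c f)) (sym (*-distribˡ-+ c (f x) (sumList (map f xs))))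

  sumList-*ʳ : ∀ (xs : List X) c (f : X → ℚ) → sumList (map (λ x → f x * c) xs) ≡ sumList (map f xs) * c
  sumList-*ʳ []       c f = sym (*-zeroˡ c)
  sumList-*ʳ (x ∷ xs) c f =
    trans (cong (f x * c +_) (sumList-*ʳ xs c f)) (sym (*-distribʳ-+ c (f x) (sumList (map f xs))))

  sumList-mono : ∀ (xs : List X) {f g : X → ℚ} → (∀ {x} → x ∈ xs → f x ≤ g x) →
                 sumList (map f xs) ≤ sumList (map g xs)
  sumList-mono []       _   = ≤-refl
  sumList-mono (x ∷ xs) f≤g = +-mono-≤ (f≤g (here refl)) (sumList-mono xs (λ x∈xs → f≤g (there x∈xs)))

  sumList-nonNeg : ∀ (xs : List X) {f : X → ℚ} → (∀ {x} → x ∈ xs → 0ℚ ≤ f x) →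
                   0ℚ ≤ sumList (map f xs)
  sumList-nonNeg []       _   = ≤-refl
  sumList-nonNeg (x ∷ xs) 0≤f = +-mono-≤ (0≤f (here refl)) (sumList-nonNeg xs (λ x∈xs → 0≤f (there x∈xs)))

∑-sumList-comm : ∀ {X : Set} (xs : List X) (F : X → Fin k → ℚ) →
                 ∑ (λ a → sumList (map (λ x → F x a) xs)) ≡ sumList (map (λ x → ∑ (F x)) xs)
∑-sumList-comm {k} []       F = ∑-zero {k}
∑-sumList-comm     (x ∷ xs) F = trans (∑-+ (F x) _) (cong (∑ (F x) +_) (∑-sumList-comm xs F))

pathSum-nonNeg : {c : Fin k → ℚ} → (∀ a → 0ℚ ≤ c a) → (xs : List⁺ (Fin k)) → 0ℚ ≤ pathSum c xs
pathSum-nonNeg 0≤c xs = sumList-nonNeg (toList xs) (λ _ → 0≤c _)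

pathSum-pos : {c : Fin k → ℚ} → (∀ a → 0ℚ < c a) → (xs : List⁺ (Fin k)) → 0ℚ < pathSum c xs
pathSum-pos 0<c (x ∷ xs) = +-mono-<-≤ (0<c x) (sumList-nonNeg xs (λ _ → <⇒≤ (0<c _)))

indicator-∷ : (c : Fin k → ℚ) (a x : Fin k) {xs : List (Fin k)} → All (x ≢_) xs →
  (if ⌊ any? (a ≟_) (x ∷ xs) ⌋ then c a else 0ℚ)
    ≡ (if ⌊ a ≟ x ⌋ then c a else 0ℚ) + (if ⌊ any? (a ≟_) xs ⌋ then c a else 0ℚ)
indicator-∷ c a x {xs} x∉xs with a ≟ x | any? (a ≟_) xs
... | yes refl | yes x∈xs = ⊥-elim (All¬⇒¬Any x∉xs x∈xs)
... | yes _    | no _     = sym (+-identityʳ _)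
... | no _     | yes _    = sym (+-identityˡ _)
... | no _     | no _     = sym (+-identityˡ _)

∑-indicator : (c : Fin k → ℚ) {xs : List (Fin k)} → Unique xs →
              ∑ (λ a → if ⌊ any? (a ≟_) xs ⌋ then c a else 0ℚ) ≡ sumList (map c xs)
∑-indicator {k} c []                     = ∑-zero {k}
∑-indicator {k} c {x ∷ xs} (x∉xs ∷ xs-uniq) = begin
  ∑ (λ a → if ⌊ any? (a ≟_) (x ∷ xs) ⌋ then c a else 0ℚ)
    ≡⟨ ∑-cong (λ a → indicator-∷ c a x x∉xs) ⟩
  ∑ (λ a → atX a + inXs a)
    ≡⟨ ∑-+ atX inXs ⟩
  ∑ atX + ∑ inXs
    ≡⟨ cong₂ _+_ (∑-pointMass x c) (∑-indicator c xs-uniq) ⟩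
  c x + sumList (map c xs)
    ∎
  where
  open ≡-Reasoning
  atX inXs : Fin k → ℚ
  atX  a = if ⌊ a ≟ x ⌋ then c a else 0ℚ
  inXs a = if ⌊ any? (a ≟_) xs ⌋ then c a else 0ℚ

restrict : (Fin k → Bool) → (Fin k → ℚ) → Fin k → ℚ
restrict keep c a = if keep a then c a else 0ℚ

restrict-nonNeg : ∀ (keep : Fin k → Bool) {c} → (∀ a → 0ℚ ≤ c a) →
                  ∀ a → 0ℚ ≤ restrict keep c a
restrict-nonNeg keep 0≤c a with keep a
... | true  = 0≤c a
... | false = ≤-refl

restrict-split : ∀ (keep : Fin k → Bool) c a → c a ≡ restrict keep c a + restrict (not ∘ keep) c a
restrict-split keep c a with keep a
... | true  = sym (+-identityʳ (c a))
... | false = sym (+-identityˡ (c a))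

relength : ∀ {D S T len len′ h h′} (P : HPath D S T len h) →
           pathSum len′ (arcs P) ≤ h′ → HPath D S T len′ h′
relength P short′ = record
  { arcs = arcs P ; chain = chain P ; startS = startS P ; endT = endT P ; simple = simple P ; short = short′ }

saturation-budget : ∀ (b : Bool) {u x y : ℚ} → 0ℚ ≤ y → x ≤ u →
  u * (if b then y else 0ℚ) + (x * y + x * y)
    ≤ (if b ∧ ⌊ ½ * u ≤? x ⌋ then u * y else 0ℚ) + (u * y + u * y)
saturation-budget false {u} {x} {y} 0≤y x≤u = begin
  u * 0ℚ + (x * y + x * y)  ≡⟨ cong (_+ (x * y + x * y)) (*-zeroʳ u) ⟩
  0ℚ + (x * y + x * y)      ≤⟨ +-monoʳ-≤ 0ℚ (+-mono-≤ xy≤uy xy≤uy) ⟩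
  0ℚ + (u * y + u * y)      ∎
  where
  open ≤-Reasoning
  xy≤uy : x * y ≤ u * y
  xy≤uy = *-monoʳ-≤-0≤ 0≤y x≤u
saturation-budget true {u} {x} {y} 0≤y x≤u with ½ * u ≤? x
... | yes _ = +-monoʳ-≤ (u * y) (+-mono-≤ xy≤uy xy≤uy)
  where
  xy≤uy : x * y ≤ u * y
  xy≤uy = *-monoʳ-≤-0≤ 0≤y x≤u
... | no ½u≰x = begin
  u * y + (x * y + x * y)  ≡⟨ cong (u * y +_) (sym (*-distribʳ-+ y x x)) ⟩
  u * y + (x + x) * y      ≤⟨ +-monoʳ-≤ (u * y) (*-monoʳ-≤-0≤ 0≤y 2x≤u) ⟩
  u * y + u * y            ≡⟨ sym (+-identityˡ _) ⟩
  0ℚ + (u * y + u * y)     ∎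
  where
  open ≤-Reasoning
  x≤½u : x ≤ ½ * u
  x≤½u = <⇒≤ (≰⇒> ½u≰x)
  2x≤u : x + x ≤ u
  2x≤u = ≤-trans (+-mono-≤ x≤½u x≤½u)
                 (≤-reflexive (solve 1 (λ u → con ½ :* u :+ con ½ :* u := u) refl u))

module _ {D : Digraph} {S T : Subset (n D)} {U len : Fin (m D) → ℚ} {h : ℚ} where

  loadCost : Flow D S T U len h → (Fin (m D) → ℚ) → ℚ
  loadCost g c = ∑ (λ a → load g a * c a)

  arcs-unique : (P : HPath D S T len h) → Unique (toList (arcs P))
  arcs-unique P = map⁻ (AllPairs.tail (simple P))

  loadCost-paths : (g : Flow D S T U len h) (c : Fin (m D) → ℚ) →
                   loadCost g c ≡ sumList (map (λ p → proj₂ p * pathSum c (arcs (proj₁ p))) (paths g))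
  loadCost-paths g c = begin
    ∑ (λ a → load g a * c a)
      ≡⟨ ∑-cong (λ a → sym (sumList-*ʳ (paths g) (c a) (flowOn a))) ⟩
    ∑ (λ a → sumList (map (λ p → flowOn a p * c a) (paths g)))
      ≡⟨ ∑-sumList-comm (paths g) (λ p a → flowOn a p * c a) ⟩
    sumList (map (λ p → ∑ (λ a → flowOn a p * c a)) (paths g))
      ≡⟨ sumList-cong (paths g) path-cost ⟩
    sumList (map (λ p → proj₂ p * pathSum c (arcs (proj₁ p))) (paths g)) ∎
    where
    open ≡-Reasoning
    flowOn : Fin (m D) → HPath D S T len h × ℚ → ℚ
    flowOn a (P , x) = if uses P a then x else 0ℚ
    path-cost : ∀ p → ∑ (λ a → flowOn a p * c a) ≡ proj₂ p * pathSum c (arcs (proj₁ p))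
    path-cost (P , x) = begin
      ∑ (λ a → (if uses P a then x else 0ℚ) * c a)  ≡⟨ ∑-cong (λ a → if-* (uses P a) x (c a)) ⟩
      ∑ (λ a → x * (if uses P a then c a else 0ℚ))  ≡⟨ ∑-*ˡ x (λ a → if uses P a then c a else 0ℚ) ⟩
      x * ∑ (λ a → if uses P a then c a else 0ℚ)    ≡⟨ cong (x *_) (∑-indicator c (arcs-unique P)) ⟩
      x * pathSum c (arcs P)                        ∎

  *-val≤loadCost : (g : Flow D S T U len h) (β : ℚ) (c : Fin (m D) → ℚ) →
                   (∀ (P : HPath D S T len h) → β ≤ pathSum c (arcs P)) → β * val g ≤ loadCost g c
  *-val≤loadCost g β c β≤c = begin
    β * val g
      ≡⟨ sym (sumList-*ˡ (paths g) β proj₂) ⟩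
    sumList (map (λ p → β * proj₂ p) (paths g))
      ≤⟨ sumList-mono (paths g) path-bound ⟩
    sumList (map (λ p → proj₂ p * pathSum c (arcs (proj₁ p))) (paths g))
      ≡⟨ sym (loadCost-paths g c) ⟩
    loadCost g c
      ∎
    where
    open ≤-Reasoning
    path-bound : ∀ {p} → p ∈ paths g → β * proj₂ p ≤ proj₂ p * pathSum c (arcs (proj₁ p))
    path-bound {P , x} p∈g = subst (_≤ x * _) (*-comm x β) (*-monoˡ-≤-0≤ (nonneg g p∈g) (β≤c P))

  loadCost≤cutValue : (g : Flow D S T U len h) {c : Fin (m D) → ℚ} → (∀ a → 0ℚ ≤ c a) →
                      loadCost g c ≤ cutValue U c
  loadCost≤cutValue g 0≤c = ∑-mono (λ a → *-monoʳ-≤-0≤ (0≤c a) (capacity g a))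

  no-paths⇒val≡0 : (HPath D S T len h → ⊥) → (g : Flow D S T U len h) → val g ≡ 0ℚ
  no-paths⇒val≡0 no-path g = no-path-values (paths g)
    where
    no-path-values : (ps : List (HPath D S T len h × ℚ)) → sumList (map proj₂ ps) ≡ 0ℚ
    no-path-values []            = refl
    no-path-values ((P , _) ∷ _) = ⊥-elim (no-path P)

  saturation-budget-∑ : (f : Flow D S T U len h) {w : Fin (m D) → ℚ} → (∀ a → 0ℚ ≤ w a) →
    cutValue U (restrict (inδ± D S T) w) + (loadCost f w + loadCost f w)
      ≤ A'Value f w + (cutValue U w + cutValue U w)
  saturation-budget-∑ f 0≤w = subst₂ _≤_ (∑-+-double _ _) (∑-+-double _ _)
    (∑-mono (λ a → saturation-budget (inδ± D S T a) (0≤w a) (capacity f a)))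
    where
    ∑-+-double : (F G : Fin (m D) → ℚ) → ∑ (λ a → F a + (G a + G a)) ≡ ∑ F + (∑ G + ∑ G)
    ∑-+-double F G = trans (∑-+ F _) (cong (∑ F +_) (∑-+ G G))

  large-ε-bound : ∀ {ε} (f : Flow D S T U len h) {w : Fin (m D) → ℚ} → 1ℚ ≤ ε →
    (∀ a → 0ℚ ≤ U a) → (∀ a → 0ℚ ≤ w a) →
    (½ - (1ℚ + 1ℚ + 1ℚ) * ε) * cutValue U w ≤ A'Value f w
  large-ε-bound {ε} f {w} 1≤ε 0≤U 0≤w = begin
    (½ - (1ℚ + 1ℚ + 1ℚ) * ε) * cutValue U w  ≤⟨ *-monoʳ-≤-0≤ (∑-nonNeg 0≤Uw) (½-3ε≤0 1≤ε) ⟩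
    0ℚ * cutValue U w                        ≡⟨ *-zeroˡ (cutValue U w) ⟩
    0ℚ                                       ≤⟨ ∑-nonNeg (restrict-nonNeg _ 0≤Uw) ⟩
    A'Value f w                              ∎
    where
    open ≤-Reasoning
    0≤Uw : ∀ a → 0ℚ ≤ U a * w a
    0≤Uw a = *-nonNeg (0≤U a) (0≤w a)

module _ {D : Digraph} {S T : Subset (n D)} {ℓ w : Fin (m D) → ℚ} {h ε : ℚ} .{{_ : Positive ε}}
         (0<ℓ : ∀ a → 0ℚ < ℓ a) (0≤w : ∀ a → 0ℚ ≤ w a) where

  private
    ℓ'-Path : Set
    ℓ'-Path = HPath D S T (ℓ' D S T ℓ w h ε) h
    ε⁻¹ : ℚ
    ε⁻¹ = (1/ ε) {{pos⇒nonZero ε}}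
    wδ wδᶜ : Fin (m D) → ℚ
    wδ  = restrict (inδ± D S T) w
    wδᶜ = restrict (not ∘ inδ± D S T) w

  pathSum-ℓ' : ∀ xs → pathSum (ℓ' D S T ℓ w h ε) xs ≡ pathSum ℓ xs + ε⁻¹ * h * pathSum wδᶜ xs
  pathSum-ℓ' xs = begin
    pathSum (ℓ' D S T ℓ w h ε) xs
      ≡⟨ sumList-cong (toList xs) (λ a → lengthen (inδ± D S T a) (ℓ a) (w a)) ⟩
    sumList (map (λ a → ℓ a + ε⁻¹ * h * wδᶜ a) (toList xs))
      ≡⟨ sumList-+ (toList xs) ℓ (λ a → ε⁻¹ * h * wδᶜ a) ⟩
    pathSum ℓ xs + sumList (map (λ a → ε⁻¹ * h * wδᶜ a) (toList xs))
      ≡⟨ cong (pathSum ℓ xs +_) (sumList-*ˡ (toList xs) (ε⁻¹ * h) wδᶜ) ⟩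
    pathSum ℓ xs + ε⁻¹ * h * pathSum wδᶜ xs
      ∎
    where
    open ≡-Reasoning
    lengthen : ∀ b x y → (if b then x else x + ε⁻¹ * h * y) ≡ x + ε⁻¹ * h * (if not b then y else 0ℚ)
    lengthen true  x y = sym (trans (cong (x +_) (*-zeroʳ (ε⁻¹ * h))) (+-identityʳ x))
    lengthen false x y = refl

  pathSum-w : ∀ xs → pathSum w xs ≡ pathSum wδ xs + pathSum wδᶜ xs
  pathSum-w xs = trans (sumList-cong (toList xs) (restrict-split (inδ± D S T) w)) (sumList-+ (toList xs) wδ wδᶜ)

  h*wδᶜ<h*ε : (P : ℓ'-Path) → h * pathSum wδᶜ (arcs P) < h * ε
  h*wδᶜ<h*ε P = h*N<h*ε (pathSum-pos 0<ℓ (arcs P)) (subst (_≤ h) (pathSum-ℓ' (arcs P)) (short P))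

  ℓ'-path⇒ℓ-path : 0ℚ < h → ℓ'-Path → HPath D S T ℓ h
  ℓ'-path⇒ℓ-path 0<h P = relength P (begin
    pathSum ℓ (arcs P)                                   ≡⟨ sym (+-identityʳ _) ⟩
    pathSum ℓ (arcs P) + 0ℚ                              ≤⟨ +-monoʳ-≤ (pathSum ℓ (arcs P)) 0≤lengthening ⟩
    pathSum ℓ (arcs P) + ε⁻¹ * h * pathSum wδᶜ (arcs P)  ≡⟨ sym (pathSum-ℓ' (arcs P)) ⟩
    pathSum (ℓ' D S T ℓ w h ε) (arcs P)                  ≤⟨ short P ⟩
    h                                                    ∎)
    where
    open ≤-Reasoning
    0≤lengthening : 0ℚ ≤ ε⁻¹ * h * pathSum wδᶜ (arcs P)
    0≤lengthening = *-nonNeg (*-nonNeg (<⇒≤ (positive⁻¹ ε⁻¹ {{1/pos⇒pos ε}})) (<⇒≤ 0<h))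
                             (pathSum-nonNeg (restrict-nonNeg (not ∘ inδ± D S T) 0≤w) (arcs P))

  1-ε≤wδ : 0ℚ < h → IsMovingCut D S T ℓ h w → (P : ℓ'-Path) → 1ℚ - ε ≤ pathSum wδ (arcs P)
  1-ε≤wδ 0<h (_ , cut) P = +-cancelʳ-≤ ε (begin
    1ℚ - ε + ε                                  ≡⟨ +-assoc 1ℚ (- ε) ε ⟩
    1ℚ + (- ε + ε)                              ≡⟨ cong (1ℚ +_) (+-inverseˡ ε) ⟩
    1ℚ + 0ℚ                                     ≤⟨ cut (ℓ'-path⇒ℓ-path 0<h P) ⟩
    pathSum w (arcs P)                          ≡⟨ pathSum-w (arcs P) ⟩
    pathSum wδ (arcs P) + pathSum wδᶜ (arcs P)  ≤⟨ +-monoʳ-≤ (pathSum wδ (arcs P)) (<⇒≤ wδᶜ<ε) ⟩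
    pathSum wδ (arcs P) + ε                     ∎)
    where
    open ≤-Reasoning
    wδᶜ<ε : pathSum wδᶜ (arcs P) < ε
    wδᶜ<ε = *-cancelˡ-<-nonNeg h {{nonNegative (<⇒≤ 0<h)}} (h*wδᶜ<h*ε P)

  ε≤w : h ≤ 0ℚ → (P : ℓ'-Path) → ε ≤ pathSum w (arcs P)
  ε≤w h≤0 P = begin
    ε                                           ≤⟨ ε≤wδᶜ ⟩
    pathSum wδᶜ (arcs P)                        ≡⟨ sym (+-identityˡ _) ⟩
    0ℚ + pathSum wδᶜ (arcs P)                   ≤⟨ +-monoˡ-≤ (pathSum wδᶜ (arcs P)) 0≤wδ ⟩
    pathSum wδ (arcs P) + pathSum wδᶜ (arcs P)  ≡⟨ sym (pathSum-w (arcs P)) ⟩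
    pathSum w (arcs P)                          ∎
    where
    open ≤-Reasoning
    0≤wδ : 0ℚ ≤ pathSum wδ (arcs P)
    0≤wδ = pathSum-nonNeg (restrict-nonNeg (inδ± D S T) 0≤w) (arcs P)
    ε≤wδᶜ : ε ≤ pathSum wδᶜ (arcs P)
    ε≤wδᶜ = ≮⇒≥ (λ wδᶜ<ε → <-irrefl refl
      (<-≤-trans (h*wδᶜ<h*ε P) (*-monoˡ-≤-nonPos h {{nonPositive h≤0}} (<⇒≤ wδᶜ<ε))))

  ℓ'-val≤½OPT-h>0 : ∀ {U} → (∀ a → 0ℚ ≤ U a) → 0ℚ < h → ε < 1ℚ
    → (f : Flow D S T U ℓ h) → IsMovingCut D S T ℓ h w → (1ℚ - ε) * cutValue U w ≤ val f
    → (fopt : Flow D S T U ℓ h) → IsMaxFlow fopt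
    → A'Value f w ≤ (½ - (1ℚ + 1ℚ + 1ℚ) * ε) * cutValue U w
    → (g : Flow D S T U (ℓ' D S T ℓ w h ε) h) → val g ≤ ½ * val fopt
  ℓ'-val≤½OPT-h>0 {U} 0≤U 0<h ε<1 f isCut@(_ , cut) approx fopt fopt-max A'-small g =
    halving-bound (<⇒≤ (positive⁻¹ ε)) ε<1 (∑-nonNeg (λ a → *-nonNeg (0≤U a) (0≤w a)))
      approx (fopt-max f) A'-small budget
    where
    g-bound : (1ℚ - ε) * val g ≤ cutValue U wδ
    g-bound = ≤-trans (*-val≤loadCost g (1ℚ - ε) wδ (1-ε≤wδ 0<h isCut))
                      (loadCost≤cutValue g (restrict-nonNeg (inδ± D S T) 0≤w))
    f-bound : val f ≤ loadCost f w
    f-bound = subst (_≤ loadCost f w) (*-identityˡ (val f)) (*-val≤loadCost f 1ℚ w cut)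
    budget : (1ℚ - ε) * val g + (val f + val f) ≤ A'Value f w + (cutValue U w + cutValue U w)
    budget = ≤-trans (+-mono-≤ g-bound (+-mono-≤ f-bound f-bound)) (saturation-budget-∑ f 0≤w)

  -- For h ≤ 0 there are no ℓ-paths, but ℓ' can be negative, so flows under ℓ' need not vanish.
  ℓ'-val≤½OPT-h≤0 : ∀ {U} → h ≤ 0ℚ → ε < 1ℚ
    → (f : Flow D S T U ℓ h) → (1ℚ - ε) * cutValue U w ≤ val f
    → (fopt : Flow D S T U ℓ h) (g : Flow D S T U (ℓ' D S T ℓ w h ε) h) → val g ≤ ½ * val fopt
  ℓ'-val≤½OPT-h≤0 {U} h≤0 ε<1 f approx fopt g = begin
    val g         ≤⟨ *≤0⇒≤0 ε ε*val≤0 ⟩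
    0ℚ            ≡⟨ sym (*-zeroʳ ½) ⟩
    ½ * 0ℚ        ≡⟨ cong (½ *_) (sym (no-paths⇒val≡0 no-ℓ-path fopt)) ⟩
    ½ * val fopt  ∎
    where
    open ≤-Reasoning
    no-ℓ-path : HPath D S T ℓ h → ⊥
    no-ℓ-path P = <-irrefl refl (<-≤-trans (pathSum-pos 0<ℓ (arcs P)) (≤-trans (short P) h≤0))
    C≤0 : cutValue U w ≤ 0ℚ
    C≤0 = *≤0⇒≤0 (1ℚ - ε) {{positive (p<q⇒0<q-p ε<1)}}
            (subst ((1ℚ - ε) * cutValue U w ≤_) (no-paths⇒val≡0 no-ℓ-path f) approx)
    ε*val≤0 : ε * val g ≤ 0ℚ
    ε*val≤0 = begin
      ε * val g     ≤⟨ *-val≤loadCost g ε w (ε≤w h≤0) ⟩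
      loadCost g w  ≤⟨ loadCost≤cutValue g 0≤w ⟩
      cutValue U w  ≤⟨ C≤0 ⟩
      0ℚ            ∎

lemma16p5 : (D : Digraph) (S T : Subset (n D)) (U ℓ : Fin (m D) → ℚ)
    → (∀ a → 0ℚ ≤ U a) → (∀ a → 0ℚ < ℓ a)
    → (h ε : ℚ) → .{{_ : Positive ε}}
    → (f : Flow D S T U ℓ h) (w : Fin (m D) → ℚ) → IsMovingCut D S T ℓ h w
    → (1ℚ - ε) * cutValue U w ≤ val f
    → (fopt : Flow D S T U ℓ h) → IsMaxFlow fopt
    → (fw : Flow D S T U (ℓ' D S T ℓ w h ε) h) → IsMaxFlow fw
    → ((½ - (1ℚ + 1ℚ + 1ℚ) * ε) * cutValue U w ≤ A'Value f w)
      ⊎ (val fw ≤ ½ * val fopt)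
lemma16p5 D S T U ℓ 0≤U 0<ℓ h ε f w isCut@(0≤w , _) approx fopt fopt-max fw _
  with ε <? 1ℚ | (½ - (1ℚ + 1ℚ + 1ℚ) * ε) * cutValue U w ≤? A'Value f w | 0ℚ <? h
... | no ε≮1  | _            | _       = inj₁ (large-ε-bound f (≮⇒≥ ε≮1) 0≤U 0≤w)
... | yes _   | yes A'-large | _       = inj₁ A'-large
... | yes ε<1 | no A'-small  | yes 0<h =
  inj₂ (ℓ'-val≤½OPT-h>0 0<ℓ 0≤w 0≤U 0<h ε<1 f isCut approx fopt fopt-max
          (<⇒≤ (≰⇒> A'-small)) fw)
... | yes ε<1 | no _         | no h≯0 =
  inj₂ (ℓ'-val≤½OPT-h≤0 0<ℓ 0≤w (≮⇒≥ h≯0) ε<1 f approx fopt fw)
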